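{- The class of all finite integer-valued antipodal metric spaces of diameter 3 has coherent EPPA: for every such space $\mathbf A$ there exist a finite integer-valued antipodal metric space $\mathbf B$ of diameter 3 containing $\mathbf A$ as a subspace, and a map $f\mapsto\hat f$ from the set of partial automorphisms of $\mathbf A$ to $\mathrm{Aut}(\mathbf B)$ such that each $\hat f$ extends $f$ and, whenever $(f,g,h)$ is a coherent triple of partial automorphisms of $\mathbf A$, the triple $(\hat f,\hat g,\hat h)$ is coherent.
   Context: An integer-valued metric space of diameter 3 is a metric space in which the distance between any two distinct points is 1, 2 or 3. It is antipodal if (1) it contains no triangle with distances $2,2,3$, and (2) the pairs at distance 3 form a perfect matching (every point has exactly one antipodal point at distance 3). Subspaces are induced. A partial automorphism of such a space is an isometry between two subspaces, where the domain and range are required to be closed under taking antipodal points. A triple $(f,g,h)$ of partial bijections is coherent if $\mathrm{Dom}(f)=\mathrm{Dom}(h)$, $\mathrm{Range}(f)=\mathrm{Dom}(g)$, $\mathrm{Range}(g)=\mathrm{Range}(h)$ and $h=g\circ f$. -}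

module Defs where

open import Data.Nat using (ℕ; _≤_; _+_)
open import Data.Fin using (Fin)
open import Data.Fin.Permutation using (Permutation′; _⟨$⟩ʳ_)
open import Data.Maybe using (Maybe; just; nothing; _>>=_)
open import Data.Product using (Σ; ∃; _×_; _,_)
open import Data.Sum using (_⊎_)
open import Relation.Binary.PropositionalEquality using (_≡_; _≢_)
open import Relation.Nullary using (¬_)
open import Function.Bundles using (_⇔_)

record AntipodalMetric3 (n : ℕ) : Set where
  field
    d        : Fin n → Fin n → ℕ
    d-self   : ∀ x → d x x ≡ 0
    d-values : ∀ x y → x ≢ y → (d x y ≡ 1 ⊎ d x y ≡ 2 ⊎ d x y ≡ 3)
    d-sym    : ∀ x y → d x y ≡ d y x
    d-tri    : ∀ x y z → d x z ≤ d x y + d y z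
    no-223   : ∀ x y z → ¬ (d x y ≡ 2 × d y z ≡ 2 × d x z ≡ 3)
    antipode-exists : ∀ x → ∃ λ y → d x y ≡ 3
    antipode-unique : ∀ x y z → d x y ≡ 3 → d x z ≡ 3 → y ≡ z

open AntipodalMetric3 public

PartialMap : ℕ → Set
PartialMap n = Fin n → Maybe (Fin n)

module _ {n : ℕ} where
  InDom : PartialMap n → Fin n → Set
  InDom p x = ∃ λ y → p x ≡ just y

  InRange : PartialMap n → Fin n → Set
  InRange p y = ∃ λ x → p x ≡ just y

record IsPartialAut {n : ℕ} (A : AntipodalMetric3 n) (p : PartialMap n) : Set where
  field
    injective    : ∀ x x' y → p x ≡ just y → p x' ≡ just y → x ≡ x'
    isometry     : ∀ x y x' y' → p x ≡ just x' → p y ≡ just y' → d A x' y' ≡ d A x y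
    dom-closed   : ∀ x y → InDom p x → d A x y ≡ 3 → InDom p y
    range-closed : ∀ x y → InRange p x → d A x y ≡ 3 → InRange p y

PartialAut : {n : ℕ} → AntipodalMetric3 n → Set
PartialAut {n} A = Σ (PartialMap n) (IsPartialAut A)

Coherent : {n : ℕ} → PartialMap n → PartialMap n → PartialMap n → Set
Coherent f g h =
  (∀ x → InDom f x ⇔ InDom h x) ×
  (∀ x → InRange f x ⇔ InDom g x) ×
  (∀ x → InRange g x ⇔ InRange h x) ×
  (∀ x → h x ≡ (f x >>= g))

record Aut {m : ℕ} (B : AntipodalMetric3 m) : Set where
  field
    perm     : Permutation′ m
    isometry : ∀ x y → d B (perm ⟨$⟩ʳ x) (perm ⟨$⟩ʳ y) ≡ d B x y

asPartial : {m : ℕ} {B : AntipodalMetric3 m} → Aut B → PartialMap m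
asPartial σ x = just (Aut.perm σ ⟨$⟩ʳ x)

record Embedding {n m : ℕ} (A : AntipodalMetric3 n) (B : AntipodalMetric3 m) : Set where
  field
    emb       : Fin n → Fin m
    injective : ∀ x y → emb x ≡ emb y → x ≡ y
    isometry  : ∀ x y → d B (emb x) (emb y) ≡ d A x y

Extends : {n m : ℕ} {A : AntipodalMetric3 n} {B : AntipodalMetric3 m} →
          Embedding A B → PartialMap n → Aut B → Set
Extends e p σ = ∀ x y → p x ≡ just y →
  Aut.perm σ ⟨$⟩ʳ Embedding.emb e x ≡ Embedding.emb e y

module Submission where

open import Defs
open import Data.Nat using (ℕ; zero; suc; _+_; _*_; _^_; _≤_; _<_; z≤n; s≤s; _<ᵇ_; _≡ᵇ_)
open import Data.Nat.Properties using (+-suc; suc-injective; ≤-antisym; +-cancelˡ-≡; ≤-trans; ≤-reflexive; +-mono-≤; m≤m+n; m≤n+m)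
open import Data.Fin using (Fin; zero; suc; toℕ; fromℕ<) renaming (_≟_ to _≟ᶠ_)
open import Data.Fin.Properties using (toℕ-fromℕ<; toℕ-injective; injective⇒≤; any?; 2↔Bool; *↔×)
open import Data.Fin.Permutation using (Permutation′; permutation; _⟨$⟩ʳ_; _⟨$⟩ˡ_; inverseˡ; inverseʳ)
open import Data.Bool using (Bool; true; false; not; _∧_; _∨_; _xor_; if_then_else_)
open import Data.Bool.Properties using (not-involutive; not-distribˡ-xor; not-distribʳ-xor; xor-assoc; xor-comm; xor-same; xor-identityʳ; true-xor; ∧-distribˡ-xor; ∧-distribʳ-xor; ∧-conicalˡ; ∧-conicalʳ) renaming (_≟_ to _≟ᵇ_)
open import Data.Bool.Solver using (module xor-∧-Solver)
open import Data.Maybe using (Maybe; just; maybe′; is-just; _>>=_)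
open import Data.Maybe.Properties using () renaming (≡-dec to Maybe-≡-dec)
open import Data.Vec using (Vec; []; _∷_; lookup; tabulate; replicate)
open import Data.Vec.Properties using (lookup∘tabulate; tabulate∘lookup; tabulate-cong; lookup-replicate) renaming (≡-dec to Vec-≡-dec)
open import Data.Product using (Σ; ∃; _×_; _,_; proj₁; proj₂)
open import Data.Product.Properties using () renaming (≡-dec to ×-≡-dec)
open import Data.Product.Function.NonDependent.Propositional using (_×-↔_)
open import Data.Sum using (_⊎_; inj₁; inj₂)
open import Data.Empty using (⊥; ⊥-elim)
open import Function using (_∘_)
open import Function.Bundles using (_↔_; _⇔_; Inverse; Equivalence; mk↔ₛ′; mk⇔)
open import Function.Properties.Inverse using (↔-refl; ↔-sym; ↔-trans)
open import Function.Construct.Symmetry using (⇔-sym)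
open import Function.Construct.Composition using () renaming (equivalence to ⇔-trans)
open import Relation.Binary.PropositionalEquality
open import Relation.Binary.Definitions using (DecidableEquality)
open import Relation.Nullary using (¬_; Dec; yes; no; does)

open xor-∧-Solver using (solve; _:=_; _:+_; con)

-- Choosing a representative in every antipodal pair of A,
-- the distances of A are the relation two (distance 2) on representatives,
-- switched by the side of each point.  The extension B is a switching
-- model: points (x , χ , i) with x ∈ A, a switching vector χ ∈ 2ⁿ and a
-- side i ∈ 2; opposite points differ in i, other distances (1 or 2)
-- follow the parity two x y + χ y + ξ x + i + j.  A embeds as
-- a ↦ (rep a , 0 , side a).  A switching (a permutation π, a side shift
-- s, a matrix T) acts by automorphisms when T x y + T y x is the defect
-- of (π , s) on {x , y}, and switchings compose componentwise.  Each
-- partial automorphism determines a switching canonically (π extends it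
-- order-preservingly on representatives, defects are charged along a
-- fixed tournament), which makes the construction coherent.

true≢false : true ≢ false
true≢false ()

not≡true : ∀ {b} → b ≡ false → not b ≡ true
not≡true refl = refl

not≡false : ∀ {b} → not b ≡ true → b ≡ false
not≡false {false} _ = refl

∨-true : ∀ {a} b → a ≡ true → a ∨ b ≡ true
∨-true b refl = refl

xor-cancel : ∀ a t → (a xor t) xor t ≡ a
xor-cancel = solve 2 (λ a t → (a :+ t) :+ t := a) refl

-- The parity identity behind balanced switchings: if the switches s , s′
-- compensate the change t ↦ u together with the shifts h , h′, then the
-- switched parity equals the original one.
xor-compensate : ∀ t u a b s s′ i j h h′ → s xor s′ ≡ (t xor u) xor (h xor h′) →
  (t xor ((a xor s) xor (b xor s′))) xor ((i xor h) xor (j xor h′)) ≡ (u xor (a xor b)) xor (i xor j)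
xor-compensate t u a b s s′ i j h h′ s+s′ = begin
  (t xor ((a xor s) xor (b xor s′))) xor ((i xor h) xor (j xor h′))
    ≡⟨ regroup t a b s s′ i j h h′ ⟩
  (s xor s′) xor ((t xor (h xor h′)) xor ((a xor b) xor (i xor j)))
    ≡⟨ cong (_xor ((t xor (h xor h′)) xor ((a xor b) xor (i xor j)))) s+s′ ⟩
  ((t xor u) xor (h xor h′)) xor ((t xor (h xor h′)) xor ((a xor b) xor (i xor j)))
    ≡⟨ cancel t u h h′ a b i j ⟩
  (u xor (a xor b)) xor (i xor j)  ∎
  where
  open ≡-Reasoning
  regroup : ∀ t a b s s′ i j h h′ →
    (t xor ((a xor s) xor (b xor s′))) xor ((i xor h) xor (j xor h′)) ≡
    (s xor s′) xor ((t xor (h xor h′)) xor ((a xor b) xor (i xor j)))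
  regroup = solve 9 (λ t a b s s′ i j h h′ →
    (t :+ ((a :+ s) :+ (b :+ s′))) :+ ((i :+ h) :+ (j :+ h′)) :=
    (s :+ s′) :+ ((t :+ (h :+ h′)) :+ ((a :+ b) :+ (i :+ j)))) refl
  cancel : ∀ t u h h′ a b i j →
    ((t xor u) xor (h xor h′)) xor ((t xor (h xor h′)) xor ((a xor b) xor (i xor j))) ≡ (u xor (a xor b)) xor (i xor j)
  cancel = solve 8 (λ t u h h′ a b i j →
    ((t :+ u) :+ (h :+ h′)) :+ ((t :+ (h :+ h′)) :+ ((a :+ b) :+ (i :+ j))) := (u :+ (a :+ b)) :+ (i :+ j)) refl

∧-true : ∀ a b → a ∧ b ≡ true → a ≡ true × b ≡ true
∧-true a b a∧b = ∧-conicalˡ a b a∧b , ∧-conicalʳ a b a∧b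

xor-cancelˡ : ∀ a b → a xor (a xor b) ≡ b
xor-cancelˡ = solve 2 (λ a b → a :+ (a :+ b) := b) refl

is-just-witness : ∀ {X : Set} (m : Maybe X) → is-just m ≡ true → ∃ λ w → m ≡ just w
is-just-witness (just w) _ = w , refl

Bool-⇔ : ∀ {a b : Bool} → (a ≡ true) ⇔ (b ≡ true) → a ≡ b
Bool-⇔ {false} {false} _ = refl
Bool-⇔ {false} {true}  a⇔b = Equivalence.from a⇔b refl
Bool-⇔ {true}  {false} a⇔b = sym (Equivalence.to a⇔b refl)
Bool-⇔ {true}  {true}  _ = refl


add : Bool → ℕ → ℕ
add true  k = suc k
add false k = k

count : ∀ {n} → (Fin n → Bool) → ℕ
count {zero}  P = 0
count {suc n} P = add (P zero) (count (P ∘ suc))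

rank : ∀ {n} → (Fin n → Bool) → Fin n → ℕ
rank P zero    = 0
rank P (suc x) = add (P zero) (rank (P ∘ suc) x)

enumStep : ∀ {n} (b : Bool) (c : ℕ) → (Fin c → Fin n) → Fin (add b c) → Fin (suc n)
enumStep true  c e zero    = zero
enumStep true  c e (suc k) = suc (e k)
enumStep false c e k       = suc (e k)

enum : ∀ {n} (P : Fin n → Bool) → Fin (count P) → Fin n
enum {zero}  P ()
enum {suc n} P = enumStep (P zero) (count (P ∘ suc)) (enum (P ∘ suc))

enum-member : ∀ {n} (P : Fin n → Bool) k → P (enum P k) ≡ true
enum-member {suc n} P = step (P zero) refl
  where
  step : ∀ b (P0 : P zero ≡ b) k → P (enumStep b _ (enum (P ∘ suc)) k) ≡ true
  step true  P0 zero    = P0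
  step true  P0 (suc k) = enum-member (P ∘ suc) k
  step false P0 k       = enum-member (P ∘ suc) k

rank-enum : ∀ {n} (P : Fin n → Bool) k → rank P (enum P k) ≡ toℕ k
rank-enum {suc n} P = step (P zero) refl
  where
  step : ∀ b (P0 : P zero ≡ b) k → rank P (enumStep b _ (enum (P ∘ suc)) k) ≡ toℕ k
  step true  P0 zero    = refl
  step true  P0 (suc k) rewrite P0 = cong suc (rank-enum (P ∘ suc) k)
  step false P0 k       rewrite P0 = rank-enum (P ∘ suc) k

rank<count : ∀ {n} (P : Fin n → Bool) x → P x ≡ true → rank P x < count P
rank<count {suc n} P zero    Px rewrite Px = s≤s z≤n
rank<count {suc n} P (suc x) Px = add-mono (P zero) (rank<count (P ∘ suc) x Px)
  where
  add-mono : ∀ b {a c} → a < c → add b a < add b c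
  add-mono true  a<c = s≤s a<c
  add-mono false a<c = a<c

enum-rank : ∀ {n} (P : Fin n → Bool) x k → P x ≡ true → toℕ k ≡ rank P x → enum P k ≡ x
enum-rank {suc n} P = step (P zero) refl
  where
  step : ∀ b (P0 : P zero ≡ b) x k → P x ≡ true → toℕ k ≡ rank P x →
         enumStep b _ (enum (P ∘ suc)) k ≡ x
  step true  P0 zero    zero    Px k≡r = refl
  step true  P0 (suc x) zero    Px k≡r rewrite P0 with k≡r
  ... | ()
  step true  P0 (suc x) (suc k) Px k≡r rewrite P0 =
    cong suc (enum-rank (P ∘ suc) x k Px (suc-injective k≡r))
  step false P0 zero    k       Px k≡r with trans (sym P0) Px
  ... | ()
  step false P0 (suc x) k       Px k≡r rewrite P0 =
    cong suc (enum-rank (P ∘ suc) x k Px k≡r)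

rank-injective : ∀ {n} (P : Fin n → Bool) x y → P x ≡ true → P y ≡ true →
                 rank P x ≡ rank P y → x ≡ y
rank-injective P x y Px Py rx≡ry =
  trans (sym (enum-rank P x k Px (toℕ-fromℕ< _)))
        (enum-rank P y k Py (trans (toℕ-fromℕ< _) rx≡ry))
  where k = fromℕ< (rank<count P x Px)

rank-cong : ∀ {n} (P Q : Fin n → Bool) → (∀ x → P x ≡ Q x) → ∀ x → rank P x ≡ rank Q x
rank-cong P Q P≗Q zero    = refl
rank-cong P Q P≗Q (suc x) rewrite P≗Q zero =
  cong (add (Q zero)) (rank-cong (P ∘ suc) (Q ∘ suc) (P≗Q ∘ suc) x)

count-complement : ∀ {n} (P : Fin n → Bool) → count P + count (not ∘ P) ≡ n
count-complement {zero}  P = refl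
count-complement {suc n} P with P zero
... | true  = cong suc (count-complement (P ∘ suc))
... | false = trans (+-suc _ _) (cong suc (count-complement (P ∘ suc)))

count-≤ : ∀ {n} (P Q : Fin n → Bool) (f : Fin n → Fin n) →
          (∀ x → P x ≡ true → Q (f x) ≡ true) →
          (∀ x y → P x ≡ true → P y ≡ true → f x ≡ f y → x ≡ y) →
          count P ≤ count Q
count-≤ P Q f PQ f-inj = injective⇒≤ {f = g} g-inj
  where
  g : Fin (count P) → Fin (count Q)
  g k = fromℕ< (rank<count Q (f (enum P k)) (PQ _ (enum-member P k)))
  g-inj : ∀ {k l} → g k ≡ g l → k ≡ l
  g-inj {k} {l} gk≡gl = toℕ-injective (begin
      toℕ k                  ≡⟨ rank-enum P k ⟨
      rank P (enum P k)      ≡⟨ cong (rank P) same-point ⟩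
      rank P (enum P l)      ≡⟨ rank-enum P l ⟩
      toℕ l                  ∎)
    where
    open ≡-Reasoning
    same-image : f (enum P k) ≡ f (enum P l)
    same-image = rank-injective Q _ _ (PQ _ (enum-member P k)) (PQ _ (enum-member P l))
      (trans (sym (toℕ-fromℕ< _)) (trans (cong toℕ gk≡gl) (toℕ-fromℕ< _)))
    same-point : enum P k ≡ enum P l
    same-point = f-inj _ _ (enum-member P k) (enum-member P l) same-image

record PartialBijection (n : ℕ) : Set where
  field
    dom ran  : Fin n → Bool
    to from  : Fin n → Fin n
    to-ran   : ∀ x → dom x ≡ true → ran (to x) ≡ true
    from-dom : ∀ y → ran y ≡ true → dom (from y) ≡ true
    to-from  : ∀ y → ran y ≡ true → to (from y) ≡ y
    from-to  : ∀ x → dom x ≡ true → from (to x) ≡ x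

  outside-dom outside-ran : Fin n → Bool
  outside-dom = not ∘ dom
  outside-ran = not ∘ ran

open PartialBijection

invert : ∀ {n} → PartialBijection n → PartialBijection n
invert P = record
  { dom = ran P ; ran = dom P ; to = from P ; from = to P
  ; to-ran = from-dom P ; from-dom = to-ran P ; to-from = from-to P ; from-to = to-from P }

module _ {n : ℕ} (P : PartialBijection n) where

  dom-ran-size : count (dom P) ≡ count (ran P)
  dom-ran-size = ≤-antisym
    (count-≤ (dom P) (ran P) (to P) (to-ran P)
      (λ x y dx dy tx≡ty → trans (sym (from-to P x dx)) (trans (cong (from P) tx≡ty) (from-to P y dy))))
    (count-≤ (ran P) (dom P) (from P) (from-dom P)
      (λ x y rx ry fx≡fy → trans (sym (to-from P x rx)) (trans (cong (to P) fx≡fy) (to-from P y ry))))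

  complement-size : count (outside-dom P) ≡ count (outside-ran P)
  complement-size = +-cancelˡ-≡ (count (dom P)) _ _ (begin
    count (dom P) + count (outside-dom P)  ≡⟨ count-complement (dom P) ⟩
    n                                      ≡⟨ count-complement (ran P) ⟨
    count (ran P) + count (outside-ran P)  ≡⟨ cong (_+ count (outside-ran P)) dom-ran-size ⟨
    count (dom P) + count (outside-ran P)  ∎)
    where open ≡-Reasoning

  -- The canonical extension to a permutation: follow the bijection on
  -- dom, and map the complement of dom onto the complement of ran
  -- preserving the order.
  extendAt : (x : Fin n) (b : Bool) → dom P x ≡ b → Fin n
  extendAt x true  _  = to P x
  extendAt x false x∉ = enum (outside-ran P) (fromℕ< (subst (rank (outside-dom P) x <_) complement-size
                          (rank<count (outside-dom P) x (not≡true x∉))))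

  extend : Fin n → Fin n
  extend x = extendAt x (dom P x) refl

  extend-dom : ∀ x → dom P x ≡ true → extend x ≡ to P x
  extend-dom x x∈ = on (dom P x) refl x∈
    where
    on : ∀ b (e : dom P x ≡ b) → b ≡ true → extendAt x b e ≡ to P x
    on true e _ = refl

  extend-outside : ∀ x → dom P x ≡ false →
                   ran P (extend x) ≡ false × rank (outside-ran P) (extend x) ≡ rank (outside-dom P) x
  extend-outside x x∉ = on (dom P x) refl x∉
    where
    on : ∀ b (e : dom P x ≡ b) → b ≡ false →
         ran P (extendAt x b e) ≡ false × rank (outside-ran P) (extendAt x b e) ≡ rank (outside-dom P) x
    on false e _ = not≡false (enum-member (outside-ran P) _) ,
                   trans (rank-enum (outside-ran P) _) (toℕ-fromℕ< _)

  ran-extend : ∀ x → ran P (extend x) ≡ dom P x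
  ran-extend x = on (dom P x) refl
    where
    on : ∀ b → dom P x ≡ b → ran P (extend x) ≡ dom P x
    on true  x∈ = trans (cong (ran P) (extend-dom x x∈)) (trans (to-ran P x x∈) (sym x∈))
    on false x∉ = trans (proj₁ (extend-outside x x∉)) (sym x∉)

extend-inverse : ∀ {n} (P : PartialBijection n) x → extend (invert P) (extend P x) ≡ x
extend-inverse P x = on (dom P x) refl
  where
  on : ∀ b → dom P x ≡ b → extend (invert P) (extend P x) ≡ x
  on true x∈ = begin
    extend (invert P) (extend P x) ≡⟨ cong (extend (invert P)) (extend-dom P x x∈) ⟩
    extend (invert P) (to P x)     ≡⟨ extend-dom (invert P) _ (to-ran P x x∈) ⟩
    from P (to P x)                ≡⟨ from-to P x x∈ ⟩
    x                              ∎
    where open ≡-Reasoning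
  on false x∉ = rank-injective (outside-dom P) _ _
      (not≡true (trans (ran-extend (invert P) (extend P x)) (trans (ran-extend P x) x∉)))
      (not≡true x∉)
      (trans (proj₂ (extend-outside (invert P) _ (proj₁ (extend-outside P x x∉))))
             (proj₂ (extend-outside P x x∉)))

-- A tournament on the points outside dom (earlier rank wins), extended
-- by letting every point of dom beat every point: "y comes before x".
before : ∀ {n} → PartialBijection n → Fin n → Fin n → Bool
before P x y = dom P y ∨ (rank (outside-dom P) y <ᵇ rank (outside-dom P) x)

<ᵇ-total : ∀ a b → a ≢ b → (a <ᵇ b) xor (b <ᵇ a) ≡ true
<ᵇ-total zero    zero    a≢b = ⊥-elim (a≢b refl)
<ᵇ-total zero    (suc b) a≢b = refl
<ᵇ-total (suc a) zero    a≢b = refl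
<ᵇ-total (suc a) (suc b) a≢b = <ᵇ-total a b (a≢b ∘ cong suc)

before-tournament : ∀ {n} (P : PartialBijection n) x y → x ≢ y → dom P x ≡ false → dom P y ≡ false →
                    before P x y xor before P y x ≡ true
before-tournament P x y x≢y x∉ y∉ rewrite x∉ | y∉ =
  <ᵇ-total (rank (outside-dom P) y) (rank (outside-dom P) x)
    (λ e → x≢y (sym (rank-injective (outside-dom P) y x (not≡true y∉) (not≡true x∉) e)))

module Composition {n : ℕ} (F G H : PartialBijection n)
  (domH : ∀ x → dom H x ≡ dom F x)
  (ranF : ∀ x → ran F x ≡ dom G x)
  (ranH : ∀ x → ran H x ≡ ran G x)
  (toH  : ∀ x → dom F x ≡ true → to H x ≡ to G (to F x)) where

  private
    rank-domH : ∀ x → rank (outside-dom H) x ≡ rank (outside-dom F) x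
    rank-domH = rank-cong (outside-dom H) (outside-dom F) (cong not ∘ domH)

    rank-domG : ∀ x → rank (outside-dom G) x ≡ rank (outside-ran F) x
    rank-domG = rank-cong (outside-dom G) (outside-ran F) (cong not ∘ sym ∘ ranF)

    rank-ranH : ∀ x → rank (outside-ran H) x ≡ rank (outside-ran G) x
    rank-ranH = rank-cong (outside-ran H) (outside-ran G) (cong not ∘ ranH)

    outside-G : ∀ x → dom F x ≡ false → dom G (extend F x) ≡ false
    outside-G x x∉ = trans (sym (ranF _)) (proj₁ (extend-outside F x x∉))

    rank-G : ∀ x → dom F x ≡ false → rank (outside-dom G) (extend F x) ≡ rank (outside-dom F) x
    rank-G x x∉ = trans (rank-domG (extend F x)) (proj₂ (extend-outside F x x∉))

  extend-compose : ∀ x → extend H x ≡ extend G (extend F x)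
  extend-compose x = on (dom F x) refl
    where
    on : ∀ b → dom F x ≡ b → extend H x ≡ extend G (extend F x)
    on true x∈ = begin
      extend H x               ≡⟨ extend-dom H x (trans (domH x) x∈) ⟩
      to H x                   ≡⟨ toH x x∈ ⟩
      to G (to F x)            ≡⟨ extend-dom G _ (trans (sym (ranF _)) (to-ran F x x∈)) ⟨
      extend G (to F x)        ≡⟨ cong (extend G) (extend-dom F x x∈) ⟨
      extend G (extend F x)    ∎
      where open ≡-Reasoning
    on false x∉ = rank-injective (outside-ran G) _ _
        (not≡true (trans (sym (ranH _)) (proj₁ (extend-outside H x x∉H))))
        (not≡true (proj₁ (extend-outside G _ (outside-G x x∉))))
        (begin
          rank (outside-ran G) (extend H x)             ≡⟨ rank-ranH (extend H x) ⟨
          rank (outside-ran H) (extend H x)             ≡⟨ proj₂ (extend-outside H x x∉H) ⟩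
          rank (outside-dom H) x                        ≡⟨ rank-domH x ⟩
          rank (outside-dom F) x                        ≡⟨ rank-G x x∉ ⟨
          rank (outside-dom G) (extend F x)             ≡⟨ proj₂ (extend-outside G _ (outside-G x x∉)) ⟨
          rank (outside-ran G) (extend G (extend F x))  ∎)
      where
      open ≡-Reasoning
      x∉H : dom H x ≡ false
      x∉H = trans (domH x) x∉

  before-transport : ∀ x y → dom F x ≡ false → before G (extend F x) (extend F y) ≡ before F x y
  before-transport x y x∉ = on (dom F y) refl
    where
    domG-y : dom G (extend F y) ≡ dom F y
    domG-y = trans (sym (ranF _)) (ran-extend F y)
    on : ∀ b → dom F y ≡ b → before G (extend F x) (extend F y) ≡ before F x y
    on true  y∈ = trans (∨-true _ (trans domG-y y∈)) (sym (∨-true _ y∈))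
    on false y∉ = cong₂ _∨_ domG-y (cong₂ _<ᵇ_ (rank-G y y∉) (rank-G x x∉))

  before-same-dom : ∀ x y → before H x y ≡ before F x y
  before-same-dom x y = cong₂ _∨_ (domH y) (cong₂ _<ᵇ_ (rank-domH y) (rank-domH x))

short : Bool → ℕ
short true  = 2
short false = 1

module ParityMetric {C : Set} (_≟_ : DecidableEquality C) (flip : C → C)
  (flip-involutive : ∀ p → flip (flip p) ≡ p) (flip-fixfree : ∀ p → flip p ≢ p)
  (par : C → C → Bool) (par-sym : ∀ p q → par p q ≡ par q p)
  (par-flip : ∀ p q → par (flip p) q ≡ not (par p q)) where

  data Position (p q : C) : Set where
    equal    : p ≡ q → Position p q
    opposite : p ≢ q → q ≡ flip p → Position p q
    generic  : p ≢ q → q ≢ flip p → Position p q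

  position : ∀ p q → Position p q
  position p q with p ≟ q | q ≟ flip p
  ... | yes p≡q | _         = equal p≡q
  ... | no  p≢q | yes q≡p̄  = opposite p≢q q≡p̄
  ... | no  p≢q | no  q≢p̄  = generic p≢q q≢p̄

  distAt : ∀ {p q} → Position p q → ℕ
  distAt (equal _)      = 0
  distAt (opposite _ _) = 3
  distAt {p} {q} (generic _ _) = short (par p q)

  dist : C → C → ℕ
  dist p q = distAt (position p q)

  dist-at : ∀ p q (v : Position p q) → dist p q ≡ distAt v
  dist-at p q v with position p q | v
  ... | equal _        | equal _        = refl
  ... | opposite _ _   | opposite _ _   = refl
  ... | generic _ _    | generic _ _    = refl
  ... | equal e        | opposite ne _  = ⊥-elim (ne e)
  ... | equal e        | generic ne _   = ⊥-elim (ne e)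
  ... | opposite ne _  | equal e        = ⊥-elim (ne e)
  ... | generic ne _   | equal e        = ⊥-elim (ne e)
  ... | opposite _ e   | generic _ ne   = ⊥-elim (ne e)
  ... | generic _ ne   | opposite _ e   = ⊥-elim (ne e)

  flip-swap : ∀ {p q} → q ≡ flip p → p ≡ flip q
  flip-swap {p} e = trans (sym (flip-involutive p)) (cong flip (sym e))

  flip-distinct : ∀ p → p ≢ flip p
  flip-distinct p = flip-fixfree p ∘ sym

  dist-self : ∀ p → dist p p ≡ 0
  dist-self p = dist-at p p (equal refl)

  dist-flip : ∀ p → dist p (flip p) ≡ 3
  dist-flip p = dist-at p (flip p) (opposite (flip-distinct p) refl)

  dist-generic : ∀ p q → p ≢ q → q ≢ flip p → dist p q ≡ short (par p q)
  dist-generic p q p≢q q≢p̄ = dist-at p q (generic p≢q q≢p̄)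

  dist≡3 : ∀ p q → dist p q ≡ 3 → q ≡ flip p
  dist≡3 p q with position p q
  ... | opposite _ q≡p̄ = λ _ → q≡p̄
  ... | equal _ = λ ()
  ... | generic _ _ with par p q
  ...   | true  = λ ()
  ...   | false = λ ()

  dist-values : ∀ p q → p ≢ q → dist p q ≡ 1 ⊎ dist p q ≡ 2 ⊎ dist p q ≡ 3
  dist-values p q p≢q with position p q
  ... | equal p≡q    = ⊥-elim (p≢q p≡q)
  ... | opposite _ _ = inj₂ (inj₂ refl)
  ... | generic _ _ with par p q
  ...   | true  = inj₂ (inj₁ refl)
  ...   | false = inj₁ refl

  dist-sym : ∀ p q → dist p q ≡ dist q p
  dist-sym p q with position p q
  ... | equal refl = sym (dist-self p)
  ... | opposite p≢q q≡p̄ = sym (dist-at q p (opposite (p≢q ∘ sym) (flip-swap q≡p̄)))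
  ... | generic p≢q q≢p̄ = trans (cong short (par-sym p q))
        (sym (dist-generic q p (p≢q ∘ sym) (λ p≡q̄ → q≢p̄ (flip-swap p≡q̄))))

  short-sum : ∀ b → short b + short (not b) ≡ 3
  short-sum true  = refl
  short-sum false = refl

  short≤2 : ∀ b → short b ≤ 2
  short≤2 true  = s≤s (s≤s z≤n)
  short≤2 false = s≤s z≤n

  dist-split : ∀ p r → p ≢ r → r ≢ flip p → dist p r + dist r (flip p) ≡ 3
  dist-split p r p≢r r≢p̄ = begin
    dist p r + dist r (flip p)                ≡⟨ cong (dist p r +_) (dist-sym r (flip p)) ⟩
    dist p r + dist (flip p) r                ≡⟨ cong₂ _+_ (dist-generic p r p≢r r≢p̄) (dist-generic (flip p) r (r≢p̄ ∘ sym) r≢p̄̄) ⟩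
    short (par p r) + short (par (flip p) r)  ≡⟨ cong (λ b → short (par p r) + short b) (par-flip p r) ⟩
    short (par p r) + short (not (par p r))   ≡⟨ short-sum (par p r) ⟩
    3                                         ∎
    where
    open ≡-Reasoning
    r≢p̄̄ : r ≢ flip (flip p)
    r≢p̄̄ r≡p = p≢r (trans (sym (flip-involutive p)) (sym r≡p))

  dist-positive : ∀ p q → p ≢ q → 1 ≤ dist p q
  dist-positive p q p≢q with dist-values p q p≢q
  ... | inj₁ e        = ≤-reflexive (sym e)
  ... | inj₂ (inj₁ e) = subst (1 ≤_) (sym e) (s≤s z≤n)
  ... | inj₂ (inj₂ e) = subst (1 ≤_) (sym e) (s≤s z≤n)

  -- Triangle inequality: distinct points are at least 1 apart and
  -- generic pairs at most 2; an antipodal pair is handled by dist-split.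
  dist-tri : ∀ x y z → dist x z ≤ dist x y + dist y z
  dist-tri x y z = triangle (x ≟ y) (y ≟ z) (position x z)
    where
    triangle : Dec (x ≡ y) → Dec (y ≡ z) → Position x z → dist x z ≤ dist x y + dist y z
    triangle (yes x≡y) _ _ = ≤-trans (≤-reflexive (cong (λ w → dist w z) x≡y)) (m≤n+m _ _)
    triangle (no _) (yes y≡z) _ = ≤-trans (≤-reflexive (cong (dist x) (sym y≡z))) (m≤m+n _ _)
    triangle (no x≢y) (no y≢z) (equal x≡z) = subst (_≤ dist x y + dist y z) (sym (dist-at x z (equal x≡z))) z≤n
    triangle (no x≢y) (no y≢z) v@(opposite _ z≡x̄) = ≤-reflexive (begin
      dist x z                    ≡⟨ dist-at x z v ⟩
      3                           ≡⟨ dist-split x y x≢y (λ y≡x̄ → y≢z (trans y≡x̄ (sym z≡x̄))) ⟨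
      dist x y + dist y (flip x)  ≡⟨ cong (λ w → dist x y + dist y w) z≡x̄ ⟨
      dist x y + dist y z         ∎)
      where open ≡-Reasoning
    triangle (no x≢y) (no y≢z) v@(generic _ _) = ≤-trans (≤-reflexive (dist-at x z v))
      (≤-trans (short≤2 (par x z)) (+-mono-≤ (dist-positive x y x≢y) (dist-positive y z y≢z)))

  -- A triangle 2 , 2 , 3 would split the distance 3 as 2 + 2.
  no-223-triangle : ∀ x y z → ¬ (dist x y ≡ 2 × dist y z ≡ 2 × dist x z ≡ 3)
  no-223-triangle x y z (xy≡2 , yz≡2 , xz≡3) with dist≡3 x z xz≡3
  ... | refl = impossible (position x y)
    where
    impossible : Position x y → ⊥
    impossible v@(equal _)      = 2≢0 (trans (sym xy≡2) (dist-at x y v))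
      where 2≢0 : 2 ≢ 0
            2≢0 ()
    impossible v@(opposite _ _) = 2≢3 (trans (sym xy≡2) (dist-at x y v))
      where 2≢3 : 2 ≢ 3
            2≢3 ()
    impossible (generic x≢y y≢x̄) = 4≢3 (trans (sym (cong₂ _+_ xy≡2 yz≡2)) (dist-split x y x≢y y≢x̄))
      where 4≢3 : 4 ≢ 3
            4≢3 ()

  dist-preserved : (φ : C → C) → (∀ {p q} → φ p ≡ φ q → p ≡ q) →
    (∀ p → φ (flip p) ≡ flip (φ p)) → (∀ p q → par (φ p) (φ q) ≡ par p q) →
    ∀ p q → dist (φ p) (φ q) ≡ dist p q
  dist-preserved φ φ-injective φ-flip φ-par p q with position p q
  ... | equal refl = dist-self (φ p)
  ... | opposite _ refl = trans (cong (dist (φ p)) (φ-flip p)) (dist-flip (φ p))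
  ... | generic p≢q q≢p̄ = trans
        (dist-generic (φ p) (φ q) (p≢q ∘ φ-injective) (λ e → q≢p̄ (φ-injective (trans e (sym (φ-flip p))))))
        (cong short (φ-par p q))

  module OnFin {m : ℕ} (index : C ↔ Fin m) where
    open Inverse index public using () renaming (to to code; from to decode; strictlyInverseˡ to code-decode; strictlyInverseʳ to decode-code)

    decode-injective : ∀ {k l} → decode k ≡ decode l → k ≡ l
    decode-injective {k} {l} e = trans (sym (code-decode k)) (trans (cong code e) (code-decode l))

    metric : AntipodalMetric3 m
    metric = record
      { d               = λ k l → dist (decode k) (decode l)
      ; d-self          = λ k → dist-self (decode k)
      ; d-values        = λ k l k≢l → dist-values (decode k) (decode l) (k≢l ∘ decode-injective)
      ; d-sym           = λ k l → dist-sym (decode k) (decode l)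
      ; d-tri           = λ k l r → dist-tri (decode k) (decode l) (decode r)
      ; no-223          = λ k l r → no-223-triangle (decode k) (decode l) (decode r)
      ; antipode-exists = λ k → code (flip (decode k)) , trans (cong (dist (decode k)) (decode-code _)) (dist-flip (decode k))
      ; antipode-unique = λ k l r kl≡3 kr≡3 → decode-injective
                            (trans (dist≡3 _ _ kl≡3) (sym (dist≡3 _ _ kr≡3)))
      }

    dist-code : ∀ p q → d metric (code p) (code q) ≡ dist p q
    dist-code p q = cong₂ dist (decode-code p) (decode-code q)

    automorphism : (Φ : C ↔ C) → (∀ p → Inverse.to Φ (flip p) ≡ flip (Inverse.to Φ p)) →
                   (∀ p q → par (Inverse.to Φ p) (Inverse.to Φ q) ≡ par p q) → Aut metric
    automorphism Φ Φ-flip Φ-par = record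
      { perm     = ↔-trans (↔-sym index) (↔-trans Φ index)
      ; isometry = λ k l → trans (dist-code _ _) (dist-preserved (Inverse.to Φ) Φ-injective Φ-flip Φ-par (decode k) (decode l))
      }
      where
      open Inverse Φ using () renaming (to to φ; from to φ⁻¹; strictlyInverseʳ to φ⁻¹∘φ)
      Φ-injective : ∀ {p q} → φ p ≡ φ q → p ≡ q
      Φ-injective {p} {q} e = trans (sym (φ⁻¹∘φ p)) (trans (cong φ⁻¹ e) (φ⁻¹∘φ q))

lookup-extensionality : ∀ {A : Set} {n} (xs ys : Vec A n) → (∀ i → lookup xs i ≡ lookup ys i) → xs ≡ ys
lookup-extensionality xs ys same = trans (sym (tabulate∘lookup xs)) (trans (tabulate-cong same) (tabulate∘lookup ys))

Vec↔Fin : ∀ n → Vec Bool n ↔ Fin (2 ^ n)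
Vec↔Fin zero    = mk↔ₛ′ (λ _ → zero) (λ _ → []) (λ { zero → refl }) (λ { [] → refl })
Vec↔Fin (suc n) = ↔-trans uncons (↔-trans (↔-sym 2↔Bool ×-↔ Vec↔Fin n) (↔-sym *↔×))
  where
  uncons : Vec Bool (suc n) ↔ (Bool × Vec Bool n)
  uncons = mk↔ₛ′ (λ { (b ∷ v) → b , v }) (λ { (b , v) → b ∷ v }) (λ { (b , v) → refl }) (λ { (b ∷ v) → refl })

-- A point
-- (x , χ , i) consists of a base point x, a switching vector χ and a
-- side i; the opposite point flips the side.
module Model (n : ℕ) (two : Fin n → Fin n → Bool) (two-sym : ∀ x y → two x y ≡ two y x) where

  Point : Set
  Point = Fin n × Vec Bool n × Bool

  _≟ₚ_ : DecidableEquality Point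
  _≟ₚ_ = ×-≡-dec _≟ᶠ_ (×-≡-dec (Vec-≡-dec _≟ᵇ_) _≟ᵇ_)

  flip : Point → Point
  flip (x , χ , i) = x , χ , not i

  flip-involutive : ∀ p → flip (flip p) ≡ p
  flip-involutive (x , χ , i) = cong (λ b → x , χ , b) (not-involutive i)

  flip-fixfree : ∀ p → flip p ≢ p
  flip-fixfree (x , χ , true)  ()
  flip-fixfree (x , χ , false) ()

  link : Fin n → Vec Bool n → Fin n → Vec Bool n → Bool
  link x χ y ξ = two x y xor (lookup χ y xor lookup ξ x)

  par : Point → Point → Bool
  par (x , χ , i) (y , ξ , j) = link x χ y ξ xor (i xor j)

  par-sym : ∀ p q → par p q ≡ par q p
  par-sym (x , χ , i) (y , ξ , j) = begin
    (two x y xor (lookup χ y xor lookup ξ x)) xor (i xor j)  ≡⟨ cong (λ t → (t xor _) xor (i xor j)) (two-sym x y) ⟩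
    (two y x xor (lookup χ y xor lookup ξ x)) xor (i xor j)  ≡⟨ swap (two y x) (lookup χ y) (lookup ξ x) i j ⟩
    (two y x xor (lookup ξ x xor lookup χ y)) xor (j xor i)  ∎
    where
    open ≡-Reasoning
    swap : ∀ t a b i j → (t xor (a xor b)) xor (i xor j) ≡ (t xor (b xor a)) xor (j xor i)
    swap = solve 5 (λ t a b i j → (t :+ (a :+ b)) :+ (i :+ j) := (t :+ (b :+ a)) :+ (j :+ i)) refl

  par-flip : ∀ p q → par (flip p) q ≡ not (par p q)
  par-flip (x , χ , i) (y , ξ , j) = begin
    link x χ y ξ xor (not i xor j)  ≡⟨ cong (link x χ y ξ xor_) (not-distribˡ-xor i j) ⟨
    link x χ y ξ xor not (i xor j)  ≡⟨ not-distribʳ-xor (link x χ y ξ) (i xor j) ⟨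
    not (par (x , χ , i) (y , ξ , j)) ∎
    where open ≡-Reasoning

  open ParityMetric _≟ₚ_ flip flip-involutive flip-fixfree par par-sym par-flip public

  size : ℕ
  size = n * (2 ^ n * 2)

  index : Point ↔ Fin size
  index = ↔-trans (↔-refl ×-↔ ↔-trans (Vec↔Fin n ×-↔ ↔-sym 2↔Bool) (↔-sym *↔×)) (↔-sym *↔×)

  open OnFin index public

  zeros : Vec Bool n
  zeros = replicate n false

  lookup-zeros : ∀ z → lookup zeros z ≡ false
  lookup-zeros z = lookup-replicate z false

  record Switching : Set where
    field
      perm   : Permutation′ n
      shift  : Fin n → Bool
      switch : Fin n → Fin n → Bool

    base base⁻¹ : Fin n → Fin n
    base   y = perm ⟨$⟩ʳ y
    base⁻¹ y = perm ⟨$⟩ˡ y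

    switched : Fin n → Vec Bool n → Vec Bool n
    switched x χ = tabulate (λ z → lookup χ (base⁻¹ z) xor switch x (base⁻¹ z))

    act : Point → Point
    act (x , χ , i) = base x , switched x χ , i xor shift x

    unact : Point → Point
    unact (y , ξ , j) = base⁻¹ y , tabulate (λ z → lookup ξ (base z) xor switch (base⁻¹ y) z) , j xor shift (base⁻¹ y)

    lookup-switched : ∀ x χ y → lookup (switched x χ) (base y) ≡ lookup χ y xor switch x y
    lookup-switched x χ y =
      trans (lookup∘tabulate _ (base y)) (cong (λ w → lookup χ w xor switch x w) (inverseˡ perm))

    -- The switching condition: switching the pair {x , y} in both
    -- directions compensates the change of two and of the sides.
    Balanced : Set
    Balanced = ∀ x y → switch x y xor switch y x ≡ (two (base x) (base y) xor two x y) xor (shift x xor shift y)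

  open Switching public

  module _ (σ : Switching) where

    unact-act : ∀ p → unact σ (act σ p) ≡ p
    unact-act (x , χ , i) rewrite inverseˡ (perm σ) {x} =
      cong (x ,_) (cong₂ _,_
        (trans (tabulate-cong (λ z → trans (cong (_xor switch σ x z) (lookup-switched σ x χ z)) (xor-cancel _ _)))
               (tabulate∘lookup χ))
        (xor-cancel i (shift σ x)))

    act-unact : ∀ p → act σ (unact σ p) ≡ p
    act-unact (y , ξ , j) = cong₂ _,_ (inverseʳ (perm σ)) (cong₂ _,_
      (trans (tabulate-cong (λ z → trans (cong (_xor switch σ (base⁻¹ σ y) (base⁻¹ σ z)) (lookup∘tabulate _ (base⁻¹ σ z)))
                (trans (xor-cancel _ _) (cong (lookup ξ) (inverseʳ (perm σ))))))
             (tabulate∘lookup ξ))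
      (xor-cancel j (shift σ (base⁻¹ σ y))))

    act↔ : Point ↔ Point
    act↔ = mk↔ₛ′ (act σ) (unact σ) act-unact unact-act

    act-flip : ∀ p → act σ (flip p) ≡ flip (act σ p)
    act-flip (x , χ , i) = cong (λ b → base σ x , switched σ x χ , b) (sym (not-distribˡ-xor i (shift σ x)))

    act-par : Balanced σ → ∀ p q → par (act σ p) (act σ q) ≡ par p q
    act-par balanced (x , χ , i) (y , ξ , j) = begin
      (two (base σ x) (base σ y) xor (lookup (switched σ x χ) (base σ y) xor lookup (switched σ y ξ) (base σ x)))
        xor ((i xor shift σ x) xor (j xor shift σ y))
        ≡⟨ cong₂ (λ a b → (two (base σ x) (base σ y) xor (a xor b)) xor ((i xor shift σ x) xor (j xor shift σ y)))
                 (lookup-switched σ x χ y) (lookup-switched σ y ξ x) ⟩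
      (two (base σ x) (base σ y) xor ((lookup χ y xor switch σ x y) xor (lookup ξ x xor switch σ y x)))
        xor ((i xor shift σ x) xor (j xor shift σ y))
        ≡⟨ xor-compensate (two (base σ x) (base σ y)) (two x y) (lookup χ y) (lookup ξ x) (switch σ x y) (switch σ y x)
                          i j (shift σ x) (shift σ y) (balanced x y) ⟩
      (two x y xor (lookup χ y xor lookup ξ x)) xor (i xor j)  ∎
      where open ≡-Reasoning

    automorphism′ : Balanced σ → Aut metric
    automorphism′ balanced = automorphism act↔ act-flip (act-par balanced)

    act-zeros : ∀ x i → (∀ y → switch σ x y ≡ false) → act σ (x , zeros , i) ≡ (base σ x , zeros , i xor shift σ x)
    act-zeros x i row = cong (λ v → base σ x , v , i xor shift σ x) (lookup-extensionality _ _ (λ z →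
      begin
        lookup (switched σ x zeros) z                          ≡⟨ lookup∘tabulate _ z ⟩
        lookup zeros (base⁻¹ σ z) xor switch σ x (base⁻¹ σ z)  ≡⟨ cong₂ _xor_ (lookup-replicate (base⁻¹ σ z) false) (row (base⁻¹ σ z)) ⟩
        false                                                  ≡⟨ lookup-replicate z false ⟨
        lookup zeros z                                         ∎))
      where open ≡-Reasoning

  act-compose : (σ τ ρ : Switching) →
    (∀ x → base ρ x ≡ base τ (base σ x)) →
    (∀ x → shift ρ x ≡ shift σ x xor shift τ (base σ x)) →
    (∀ x y → switch ρ x y ≡ switch σ x y xor switch τ (base σ x) (base σ y)) →
    ∀ p → act ρ p ≡ act τ (act σ p)
  act-compose σ τ ρ base-ρ shift-ρ switch-ρ (x , χ , i) =
    cong₂ _,_ (base-ρ x) (cong₂ _,_ (lookup-extensionality _ _ entries)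
      (trans (cong (i xor_) (shift-ρ x)) (sym (xor-assoc i _ _))))
    where
    open ≡-Reasoning
    at-image : ∀ w → lookup (switched ρ x χ) (base ρ w) ≡ lookup (switched τ (base σ x) (switched σ x χ)) (base ρ w)
    at-image w = begin
      lookup (switched ρ x χ) (base ρ w)                                      ≡⟨ lookup-switched ρ x χ w ⟩
      lookup χ w xor switch ρ x w                                             ≡⟨ cong (lookup χ w xor_) (switch-ρ x w) ⟩
      lookup χ w xor (switch σ x w xor switch τ (base σ x) (base σ w))         ≡⟨ xor-assoc (lookup χ w) _ _ ⟨
      (lookup χ w xor switch σ x w) xor switch τ (base σ x) (base σ w)         ≡⟨ cong (_xor _) (lookup-switched σ x χ w) ⟨
      lookup (switched σ x χ) (base σ w) xor switch τ (base σ x) (base σ w)    ≡⟨ lookup-switched τ (base σ x) (switched σ x χ) (base σ w) ⟨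
      lookup (switched τ (base σ x) (switched σ x χ)) (base τ (base σ w))     ≡⟨ cong (lookup (switched τ (base σ x) (switched σ x χ))) (base-ρ w) ⟨
      lookup (switched τ (base σ x) (switched σ x χ)) (base ρ w)              ∎
    entries : ∀ z → lookup (switched ρ x χ) z ≡ lookup (switched τ (base σ x) (switched σ x χ)) z
    entries z = subst (λ z′ → lookup (switched ρ x χ) z′ ≡ lookup (switched τ (base σ x) (switched σ x χ)) z′)
                      (inverseʳ (perm ρ)) (at-image (base⁻¹ ρ z))

d≡0 : ∀ {m} (B : AntipodalMetric3 m) x y → d B x y ≡ 0 → x ≡ y
d≡0 B x y xy≡0 with x ≟ᶠ y
... | yes x≡y = x≡y
... | no  x≢y with d-values B x y x≢y
...   | inj₁ e        = ⊥-elim (case (trans (sym xy≡0) e))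
  where case : 0 ≢ 1
        case ()
...   | inj₂ (inj₁ e) = ⊥-elim (case (trans (sym xy≡0) e))
  where case : 0 ≢ 2
        case ()
...   | inj₂ (inj₂ e) = ⊥-elim (case (trans (sym xy≡0) e))
  where case : 0 ≢ 3
        case ()

-- The antipodal and two-graph structure of a space A: each antipodal
-- pair {x , opp x} has a chosen representative rep x (the one with the
-- smaller index), and side x records whether x is the other one.  The
-- distances of A are determined by the relation two on representatives.
module Antipodal {n : ℕ} (A : AntipodalMetric3 n) where

  opp : Fin n → Fin n
  opp x = proj₁ (antipode-exists A x)

  d-opp : ∀ x → d A x (opp x) ≡ 3
  d-opp x = proj₂ (antipode-exists A x)

  opp-unique : ∀ x y → d A x y ≡ 3 → y ≡ opp x
  opp-unique x y xy≡3 = antipode-unique A x y (opp x) xy≡3 (d-opp x)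

  opp-involutive : ∀ x → opp (opp x) ≡ x
  opp-involutive x = sym (opp-unique (opp x) x (trans (d-sym A (opp x) x) (d-opp x)))

  opp-distinct : ∀ x → opp x ≢ x
  opp-distinct x x̄≡x = case (trans (sym (d-opp x)) (trans (cong (d A x) x̄≡x) (d-self A x)))
    where case : 3 ≢ 0
          case ()

  two : Fin n → Fin n → Bool
  two x y = d A x y ≡ᵇ 2

  two-sym : ∀ x y → two x y ≡ two y x
  two-sym x y = cong (_≡ᵇ 2) (d-sym A x y)

  two-self : ∀ x → two x x ≡ false
  two-self x = cong (_≡ᵇ 2) (d-self A x)

  d-generic : ∀ x y → y ≢ x → y ≢ opp x → d A x y ≡ short (two x y)
  d-generic x y y≢x y≢x̄ with d-values A x y (y≢x ∘ sym)
  ... | inj₁ e        rewrite e = refl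
  ... | inj₂ (inj₁ e) rewrite e = refl
  ... | inj₂ (inj₂ e) = ⊥-elim (y≢x̄ (opp-unique x y e))

  -- Replacing x by its antipode complements the distance to y (within
  -- {1 , 2}): this is where both antipodality axioms are used.
  two-opp : ∀ x y → y ≢ x → y ≢ opp x → two (opp x) y ≡ not (two x y)
  two-opp x y y≢x y≢x̄ with d-values A x y (y≢x ∘ sym) | d-values A (opp x) y (y≢x̄ ∘ sym)
  ... | inj₂ (inj₂ e) | _ = ⊥-elim (y≢x̄ (opp-unique x y e))
  ... | _ | inj₂ (inj₂ e) = ⊥-elim (y≢x (trans (opp-unique (opp x) y e) (opp-involutive x)))
  ... | inj₁ e₁ | inj₁ e₂ = ⊥-elim (3≰2 (≤-trans (≤-reflexive (sym (d-opp x)))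
          (≤-trans (d-tri A x y (opp x)) (≤-reflexive (cong₂ _+_ e₁ (trans (d-sym A y (opp x)) e₂))))))
    where 3≰2 : 3 ≤ 2 → ⊥
          3≰2 (s≤s (s≤s ()))
  ... | inj₁ e₁ | inj₂ (inj₁ e₂) rewrite e₁ | e₂ = refl
  ... | inj₂ (inj₁ e₁) | inj₁ e₂ rewrite e₁ | e₂ = refl
  ... | inj₂ (inj₁ e₁) | inj₂ (inj₁ e₂) =
          ⊥-elim (no-223 A x y (opp x) (e₁ , trans (d-sym A y (opp x)) e₂ , d-opp x))

  lower : Fin n → Bool
  lower x = toℕ x <ᵇ toℕ (opp x)

  side : Fin n → Bool
  side x = not (lower x)

  rep : Fin n → Fin n
  rep x = if lower x then x else opp x

  lower-opp : ∀ x → lower (opp x) ≡ not (lower x)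
  lower-opp x = begin
    toℕ (opp x) <ᵇ toℕ (opp (opp x))  ≡⟨ cong (λ w → toℕ (opp x) <ᵇ toℕ w) (opp-involutive x) ⟩
    toℕ (opp x) <ᵇ toℕ x              ≡⟨ exclusive (toℕ x) (toℕ (opp x)) (λ e → opp-distinct x (sym (toℕ-injective e))) ⟩
    not (lower x)                     ∎
    where
    open ≡-Reasoning
    exclusive : ∀ a b → a ≢ b → (b <ᵇ a) ≡ not (a <ᵇ b)
    exclusive a b a≢b with a <ᵇ b | b <ᵇ a | <ᵇ-total a b a≢b
    ... | true  | false | _ = refl
    ... | false | true  | _ = refl

  side-opp : ∀ x → side (opp x) ≡ not (side x)
  side-opp x = cong not (lower-opp x)

  data Representative (x : Fin n) : Set where
    itself : lower x ≡ true  → rep x ≡ x     → side x ≡ false → Representative x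
    across : lower x ≡ false → rep x ≡ opp x → side x ≡ true  → Representative x

  representative : ∀ x → Representative x
  representative x = by (lower x) refl
    where
    by : ∀ b → lower x ≡ b → Representative x
    by true  l = itself l (cong (if_then x else opp x) l) (cong not l)
    by false l = across l (cong (if_then x else opp x) l) (cong not l)

  representative-lower : ∀ x → lower x ≡ true → rep x ≡ x
  representative-lower x l = cong (if_then x else opp x) l

  rep-opp : ∀ x → rep (opp x) ≡ rep x
  rep-opp x with representative x | representative (opp x)
  ... | itself _ r _ | across _ r̄ _ = trans r̄ (trans (opp-involutive x) (sym r))
  ... | across _ r _ | itself _ r̄ _ = trans r̄ (sym r)
  ... | itself l _ _ | itself l̄ _ _ = ⊥-elim (true≢false (trans (sym l̄) (trans (lower-opp x) (cong not l))))
  ... | across l _ _ | across l̄ _ _ = ⊥-elim (true≢false (trans (sym (cong not l)) (trans (sym (lower-opp x)) l̄)))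

  lower-rep : ∀ x → lower (rep x) ≡ true
  lower-rep x with representative x
  ... | itself l r _ = trans (cong lower r) l
  ... | across l r _ = trans (cong lower r) (trans (lower-opp x) (cong not l))

  rep-injective : ∀ a b → rep a ≡ rep b → b ≡ a ⊎ b ≡ opp a
  rep-injective a b ra≡rb with representative a | representative b
  ... | itself _ ra _ | itself _ rb _ = inj₁ (trans (sym rb) (trans (sym ra≡rb) ra))
  ... | itself _ ra _ | across _ rb _ = inj₂ (trans (sym (opp-involutive b)) (cong opp (trans (sym rb) (trans (sym ra≡rb) ra))))
  ... | across _ ra _ | itself _ rb _ = inj₂ (trans (sym rb) (trans (sym ra≡rb) ra))
  ... | across _ ra _ | across _ rb _ = inj₁ (trans (sym (opp-involutive b))
          (trans (cong opp (trans (sym rb) (trans (sym ra≡rb) ra))) (opp-involutive a)))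

  two-rep : ∀ a b → b ≢ a → b ≢ opp a → two (rep a) b ≡ two a b xor side a
  two-rep a b b≢a b≢ā with representative a
  ... | itself _ r s rewrite r | s = sym (xor-identityʳ (two a b))
  ... | across _ r s rewrite r | s = trans (two-opp a b b≢a b≢ā) (sym (trans (xor-comm (two a b) true) (true-xor (two a b))))

  rep-generic : ∀ a b → b ≢ a → b ≢ opp a → rep b ≢ a × rep b ≢ opp a
  rep-generic a b b≢a b≢ā with representative b
  ... | itself _ r _ = (λ e → b≢a (trans (sym r) e)) , (λ e → b≢ā (trans (sym r) e))
  ... | across _ r _ = (λ e → b≢ā (trans (sym (opp-involutive b)) (cong opp (trans (sym r) e))))
                     , (λ e → b≢a (trans (sym (opp-involutive b)) (trans (cong opp (trans (sym r) e)) (opp-involutive a))))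

  generic-sym : ∀ a b → b ≢ a → b ≢ opp a → a ≢ b × a ≢ opp b
  generic-sym a b b≢a b≢ā = b≢a ∘ sym , (λ e → b≢ā (trans (sym (opp-involutive b)) (cong opp (sym e))))

  two-reps : ∀ a b → b ≢ a → b ≢ opp a → two (rep a) (rep b) ≡ (two a b xor side a) xor side b
  two-reps a b b≢a b≢ā = begin
    two (rep a) (rep b)                    ≡⟨ two-rep a (rep b) (proj₁ rb) (proj₂ rb) ⟩
    two a (rep b) xor side a               ≡⟨ cong (_xor side a) (two-sym a (rep b)) ⟩
    two (rep b) a xor side a               ≡⟨ cong (_xor side a) (two-rep b a (proj₁ ab) (proj₂ ab)) ⟩
    (two b a xor side b) xor side a        ≡⟨ cong (λ t → (t xor side b) xor side a) (two-sym b a) ⟩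
    (two a b xor side b) xor side a        ≡⟨ swap (two a b) (side b) (side a) ⟩
    (two a b xor side a) xor side b        ∎
    where
    open ≡-Reasoning
    rb = rep-generic a b b≢a b≢ā
    ab = generic-sym a b b≢a b≢ā
    swap : ∀ t u v → (t xor u) xor v ≡ (t xor v) xor u
    swap t u v = trans (xor-assoc t u v) (trans (cong (t xor_) (xor-comm u v)) (sym (xor-assoc t v u)))

module Construction {n : ℕ} (A : AntipodalMetric3 n) where
  open Antipodal A
  open Model n two two-sym public

  point : Fin n → Point
  point a = rep a , zeros , side a

  -- The embedding is an isometry: generic pairs by two-reps, antipodal
  -- pairs because point (opp a) = flip (point a).
  dist-point : ∀ a b → dist (point a) (point b) ≡ d A a b
  dist-point a b with b ≟ᶠ a | b ≟ᶠ opp a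
  ... | yes refl | _ = trans (dist-self (point a)) (sym (d-self A a))
  ... | no _ | yes refl = begin
      dist (point a) (point (opp a))   ≡⟨ cong (dist (point a)) point-opp ⟩
      dist (point a) (flip (point a))  ≡⟨ dist-flip (point a) ⟩
      3                                ≡⟨ d-opp a ⟨
      d A a (opp a)                    ∎
    where
    open ≡-Reasoning
    point-opp : point (opp a) ≡ flip (point a)
    point-opp = cong₂ _,_ (rep-opp a) (cong (zeros ,_) (side-opp a))
  ... | no b≢a | no b≢ā = begin
      dist (point a) (point b)                   ≡⟨ dist-generic (point a) (point b) (reps-differ ∘ cong proj₁) (reps-differ ∘ sym ∘ cong proj₁) ⟩
      short (par (point a) (point b))            ≡⟨ cong short parity ⟩
      short (two a b)                            ≡⟨ d-generic a b b≢a b≢ā ⟨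
      d A a b                                    ∎
    where
    open ≡-Reasoning
    reps-differ : rep a ≢ rep b
    reps-differ ra≡rb with rep-injective a b ra≡rb
    ... | inj₁ b≡a = b≢a b≡a
    ... | inj₂ b≡ā = b≢ā b≡ā
    parity : par (point a) (point b) ≡ two a b
    parity = begin
      (two (rep a) (rep b) xor (lookup zeros (rep b) xor lookup zeros (rep a))) xor (side a xor side b)
        ≡⟨ cong₂ (λ t u → (t xor u) xor (side a xor side b)) (two-reps a b b≢a b≢ā)
                 (cong₂ _xor_ (lookup-zeros (rep b)) (lookup-zeros (rep a))) ⟩
      (((two a b xor side a) xor side b) xor (false xor false)) xor (side a xor side b)
        ≡⟨ unswitch (two a b) (side a) (side b) ⟩
      two a b ∎
      where
      unswitch : ∀ t u v → (((t xor u) xor v) xor (false xor false)) xor (u xor v) ≡ t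
      unswitch = solve 3 (λ t u v → (((t :+ u) :+ v) :+ (con false :+ con false)) :+ (u :+ v) := t) refl

  embedding : Embedding A metric
  embedding = record
    { emb       = code ∘ point
    ; injective = λ a b same → d≡0 A a b (begin
        d A a b                                    ≡⟨ isometry a b ⟨
        d metric (code (point a)) (code (point b)) ≡⟨ cong (d metric (code (point a))) same ⟨
        d metric (code (point a)) (code (point a)) ≡⟨ d-self metric _ ⟩
        0                                          ∎)
    ; isometry  = isometry
    }
    where
    open ≡-Reasoning
    isometry : ∀ a b → d metric (code (point a)) (code (point b)) ≡ d A a b
    isometry a b = trans (dist-code (point a) (point b)) (dist-point a b)

  module Extension (f : PartialAut A) where
    p : PartialMap n
    p = proj₁ f
    open IsPartialAut (proj₂ f)

    p-opp : ∀ {x y} → p x ≡ just y → p (opp x) ≡ just (opp y)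
    p-opp {x} {y} px≡y with dom-closed x (opp x) (y , px≡y) (d-opp x)
    ... | z , px̄≡z = trans px̄≡z (cong just (opp-unique y z (trans (isometry x (opp x) y z px≡y px̄≡z) (d-opp x))))

    -- f induces a partial bijection on representatives; the side
    -- shift records on which side of its pair the image lands.
    preimage? : ∀ y → Dec (InRange p y)
    preimage? y = any? (λ z → Maybe-≡-dec _≟ᶠ_ (p z) (just y))

    preimageRep : ∀ {y} → Dec (InRange p y) → Fin n
    preimageRep     (yes (z , _)) = rep z
    preimageRep {y} (no _)        = y

    domain range : Fin n → Bool
    domain x = lower x ∧ is-just (p x)
    range  y = lower y ∧ does (preimage? y)

    image preimage : Fin n → Fin n
    image    x = maybe′ rep x (p x)
    preimage y = preimageRep (preimage? y)

    shift′ : Fin n → Bool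
    shift′ x = domain x ∧ maybe′ side false (p x)

    image-just : ∀ {x w} → p x ≡ just w → image x ≡ rep w
    image-just {x} = cong (maybe′ rep x)

    domain-just : ∀ {x w} → p x ≡ just w → lower x ≡ true → domain x ≡ true
    domain-just px≡w l = cong₂ _∧_ l (cong is-just px≡w)

    shift-just : ∀ {x w} → p x ≡ just w → lower x ≡ true → shift′ x ≡ side w
    shift-just px≡w l = cong₂ _∧_ (domain-just px≡w l) (cong (maybe′ side false) px≡w)

    domain-true : ∀ x → domain x ≡ true → lower x ≡ true × ∃ λ w → p x ≡ just w
    domain-true x x∈ = proj₁ parts , is-just-witness (p x) (proj₂ parts)
      where parts = ∧-true (lower x) (is-just (p x)) x∈

    in-range : ∀ {y} → InRange p y → does (preimage? y) ≡ true
    in-range {y} r with preimage? y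
    ... | yes _ = refl
    ... | no ∉ = ⊥-elim (∉ r)

    preimage-spec : ∀ y → does (preimage? y) ≡ true → ∃ λ z → p z ≡ just y × preimage y ≡ rep z
    preimage-spec y hit with preimage? y
    ... | yes (z , pz≡y) = z , pz≡y , refl

    image-rep : ∀ {z w} → p z ≡ just w → image (rep z) ≡ rep w
    image-rep {z} {w} pz≡w with representative z
    ... | itself _ r _ = trans (cong image r) (image-just pz≡w)
    ... | across _ r _ = trans (cong image r) (trans (image-just (p-opp pz≡w)) (rep-opp w))

    domain-rep : ∀ {z w} → p z ≡ just w → domain (rep z) ≡ true
    domain-rep {z} pz≡w with representative z
    ... | itself _ r _ = trans (cong domain r) (domain-just pz≡w (trans (sym (cong lower r)) (lower-rep z)))
    ... | across _ r _ = trans (cong domain r) (domain-just (p-opp pz≡w) (trans (sym (cong lower r)) (lower-rep z)))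

    shift-rep : ∀ {z w} → p z ≡ just w → shift′ (rep z) ≡ side z xor side w
    shift-rep {z} {w} pz≡w with representative z
    ... | itself _ r s rewrite s = trans (cong shift′ r) (shift-just pz≡w (trans (sym (cong lower r)) (lower-rep z)))
    ... | across _ r s rewrite s = trans (cong shift′ r)
          (trans (shift-just (p-opp pz≡w) (trans (sym (cong lower r)) (lower-rep z))) (side-opp w))

    range-rep : ∀ {x w} → p x ≡ just w → InRange p (rep w)
    range-rep {x} {w} px≡w with representative w
    ... | itself _ r _ = x , trans px≡w (cong just (sym r))
    ... | across _ r _ = opp x , trans (p-opp px≡w) (cong just (sym r))

    image-range : ∀ x → domain x ≡ true → range (image x) ≡ true
    image-range x x∈ with domain-true x x∈
    ... | _ , w , px≡w = trans (cong range (image-just px≡w)) (cong₂ _∧_ (lower-rep w) (in-range (range-rep px≡w)))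

    preimage-domain : ∀ y → range y ≡ true → domain (preimage y) ≡ true
    preimage-domain y y∈ with preimage-spec y (proj₂ (∧-true (lower y) _ y∈))
    ... | z , pz≡y , pre≡z = trans (cong domain pre≡z) (domain-rep pz≡y)

    image-preimage : ∀ y → range y ≡ true → image (preimage y) ≡ y
    image-preimage y y∈ with preimage-spec y (proj₂ (∧-true (lower y) _ y∈))
    ... | z , pz≡y , pre≡z with representative y
    ...   | itself _ r _ = trans (cong image pre≡z) (trans (image-rep pz≡y) r)
    ...   | across l _ _ = ⊥-elim (true≢false (trans (sym (proj₁ (∧-true (lower y) _ y∈))) l))

    preimage-image : ∀ x → domain x ≡ true → preimage (image x) ≡ x
    preimage-image x x∈ with domain-true x x∈
    ... | l , w , px≡w with preimage-spec (image x) (proj₂ (∧-true _ _ (image-range x x∈)))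
    ...   | z , pz≡ , pre≡z = trans pre≡z (same-pair (representative w))
      where
      same-pair : Representative w → rep z ≡ x
      same-pair (itself _ r _) = trans (cong rep (injective z x w (trans pz≡ (cong just (trans (image-just px≡w) r))) px≡w))
                                       (representative-lower x l)
      same-pair (across _ r _) = trans (cong rep (injective z (opp x) (opp w) (trans pz≡ (cong just (trans (image-just px≡w) r))) (p-opp px≡w)))
                                       (trans (rep-opp x) (representative-lower x l))

    partialBijection : PartialBijection n
    partialBijection = record
      { dom = domain ; ran = range ; to = image ; from = preimage
      ; to-ran = image-range ; from-dom = preimage-domain ; to-from = image-preimage ; from-to = preimage-image }

    π : Fin n → Fin n
    π = extend partialBijection

    permutationOf : Permutation′ n
    permutationOf = permutation π (extend (invert partialBijection))
      (extend-inverse (invert partialBijection)) (extend-inverse partialBijection)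

    -- How far π with the side shift fails to preserve two on a pair.
    defect : Fin n → Fin n → Bool
    defect x y = (two (π x) (π y) xor two x y) xor (shift′ x xor shift′ y)

    -- The defect of a pair is put on the row of the point outside the
    -- domain that comes first in the tournament.
    switch′ : Fin n → Fin n → Bool
    switch′ x y = not (domain x) ∧ (before partialBijection x y ∧ defect x y)

    defect-sym : ∀ x y → defect x y ≡ defect y x
    defect-sym x y = cong₂ _xor_ (cong₂ _xor_ (two-sym (π x) (π y)) (two-sym x y)) (xor-comm (shift′ x) (shift′ y))

    defect-self : ∀ x → defect x x ≡ false
    defect-self x = begin
      (two (π x) (π x) xor two x x) xor (shift′ x xor shift′ x)  ≡⟨ cong₂ (λ a b → (a xor b) xor (shift′ x xor shift′ x)) (two-self (π x)) (two-self x) ⟩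
      shift′ x xor shift′ x                                        ≡⟨ xor-same (shift′ x) ⟩
      false                                                        ∎
      where open ≡-Reasoning

    -- On the domain f is an isometry, so there is no defect.
    defect-domain : ∀ x y → x ≢ y → domain x ≡ true → domain y ≡ true → defect x y ≡ false
    defect-domain x y x≢y x∈ y∈ with domain-true x x∈ | domain-true y y∈
    ... | lx , zx , px≡zx | ly , zy , py≡zy = begin
      (two (π x) (π y) xor two x y) xor (shift′ x xor shift′ y)
        ≡⟨ cong₂ (λ a b → (a xor b) xor (shift′ x xor shift′ y)) two-images (cong (_≡ᵇ 2) (sym (isometry x y zx zy px≡zx py≡zy))) ⟩
      (((two zx zy xor side zx) xor side zy) xor two zx zy) xor (shift′ x xor shift′ y)
        ≡⟨ cong₂ (λ a b → (((two zx zy xor side zx) xor side zy) xor two zx zy) xor (a xor b)) (shift-just px≡zx lx) (shift-just py≡zy ly) ⟩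
      (((two zx zy xor side zx) xor side zy) xor two zx zy) xor (side zx xor side zy)
        ≡⟨ cancel (two zx zy) (side zx) (side zy) ⟩
      false ∎
      where
      open ≡-Reasoning
      zy≢zx : zy ≢ zx
      zy≢zx e = x≢y (injective x y zx px≡zx (trans py≡zy (cong just e)))
      zy≢z̄x : zy ≢ opp zx
      zy≢z̄x e = true≢false (begin
        true          ≡⟨ ly ⟨
        lower y       ≡⟨ cong lower (injective y (opp x) (opp zx) (trans py≡zy (cong just e)) (p-opp px≡zx)) ⟩
        lower (opp x) ≡⟨ lower-opp x ⟩
        not (lower x) ≡⟨ cong not lx ⟩
        false         ∎)
      two-images : two (π x) (π y) ≡ (two zx zy xor side zx) xor side zy
      two-images = trans (cong₂ two (trans (extend-dom partialBijection x x∈) (image-just px≡zx))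
                                    (trans (extend-dom partialBijection y y∈) (image-just py≡zy)))
                         (two-reps zx zy zy≢zx zy≢z̄x)
      cancel : ∀ t u v → (((t xor u) xor v) xor t) xor (u xor v) ≡ false
      cancel = solve 3 (λ t u v → (((t :+ u) :+ v) :+ t) :+ (u :+ v) := con false) refl

    shift-outside : ∀ x → domain x ≡ false → shift′ x ≡ false
    shift-outside x x∉ = cong (_∧ maybe′ side false (p x)) x∉

    switch-outside : ∀ x y → domain x ≡ true → switch′ x y ≡ false
    switch-outside x y x∈ = cong (λ b → not b ∧ (before partialBijection x y ∧ defect x y)) x∈

    switch-inside : ∀ x y → domain x ≡ false → switch′ x y ≡ before partialBijection x y ∧ defect x y
    switch-inside x y x∉ = cong (λ b → not b ∧ (before partialBijection x y ∧ defect x y)) x∉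

    switch-split : ∀ x y → switch′ x y xor switch′ y x ≡ defect x y
    switch-split x y with x ≟ᶠ y
    ... | yes refl = trans (xor-same (switch′ x x)) (sym (defect-self x))
    ... | no x≢y = by-domain (domain x) (domain y) refl refl
      where
      by-domain : ∀ b b′ → domain x ≡ b → domain y ≡ b′ → switch′ x y xor switch′ y x ≡ defect x y
      by-domain true true x∈ y∈ =
        trans (cong₂ _xor_ (switch-outside x y x∈) (switch-outside y x y∈)) (sym (defect-domain x y x≢y x∈ y∈))
      by-domain true false x∈ y∉ =
        trans (cong₂ _xor_ (switch-outside x y x∈) (trans (switch-inside y x y∉) (cong (_∧ defect y x) (∨-true _ x∈))))
              (defect-sym y x)
      by-domain false true x∉ y∈ =
        trans (cong₂ _xor_ (trans (switch-inside x y x∉) (cong (_∧ defect x y) (∨-true _ y∈))) (switch-outside y x y∈))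
              (xor-identityʳ (defect x y))
      by-domain false false x∉ y∉ = begin
        switch′ x y xor switch′ y x
          ≡⟨ cong₂ _xor_ (switch-inside x y x∉) (trans (switch-inside y x y∉) (cong (before partialBijection y x ∧_) (defect-sym y x))) ⟩
        (before partialBijection x y ∧ defect x y) xor (before partialBijection y x ∧ defect x y)
          ≡⟨ ∧-distribʳ-xor (defect x y) (before partialBijection x y) (before partialBijection y x) ⟨
        (before partialBijection x y xor before partialBijection y x) ∧ defect x y
          ≡⟨ cong (_∧ defect x y) (before-tournament partialBijection x y x≢y x∉ y∉) ⟩
        defect x y ∎
        where open ≡-Reasoning

    switching : Switching
    switching = record { perm = permutationOf ; shift = shift′ ; switch = switch′ }

    extension : Aut metric
    extension = automorphism′ switching switch-split

    act-point : ∀ {a b} → p a ≡ just b → act switching (point a) ≡ point b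
    act-point {a} {b} pa≡b = trans (act-zeros switching (rep a) (side a) (λ y → switch-outside (rep a) y (domain-rep pa≡b)))
      (cong₂ _,_ (trans (extend-dom partialBijection (rep a) (domain-rep pa≡b)) (image-rep pa≡b))
                 (cong (zeros ,_) (trans (cong (side a xor_) (shift-rep pa≡b)) (xor-cancelˡ (side a) (side b)))))

    extends : Extends embedding p extension
    extends a b pa≡b = cong code (trans (cong (act switching) (decode-code (point a))) (act-point pa≡b))

  is-just⇔InDom : ∀ (q : PartialMap n) x → (is-just (q x) ≡ true) ⇔ InDom q x
  is-just⇔InDom q x = mk⇔ (is-just-witness (q x)) (λ (w , qx≡w) → cong is-just qx≡w)

  -- For a coherent triple (f , g , h) the switchings of h and of g ∘ f
  -- agree in all three components, so the extensions compose.
  module Coherence (f g h : PartialAut A) (coh : Coherent (proj₁ f) (proj₁ g) (proj₁ h)) where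
    module F = Extension f
    module G = Extension g
    module H = Extension h

    private
      dom-fh   = proj₁ coh
      ran-f-dom-g = proj₁ (proj₂ coh)
      ran-gh   = proj₁ (proj₂ (proj₂ coh))
      h≡g∘f    = proj₂ (proj₂ (proj₂ coh))

      does⇔InRange : (e : PartialAut A) → ∀ y → (does (Extension.preimage? e y) ≡ true) ⇔ InRange (proj₁ e) y
      does⇔InRange e y = mk⇔ (λ hit → let (z , pz≡y , _) = Extension.preimage-spec e y hit in z , pz≡y) (Extension.in-range e)

    domain-h : ∀ x → H.domain x ≡ F.domain x
    domain-h x = cong (lower x ∧_) (Bool-⇔ (⇔-trans (is-just⇔InDom H.p x) (⇔-trans (⇔-sym (dom-fh x)) (⇔-sym (is-just⇔InDom F.p x)))))

    range-f : ∀ x → F.range x ≡ G.domain x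
    range-f x = cong (lower x ∧_) (Bool-⇔ (⇔-trans (does⇔InRange f x) (⇔-trans (ran-f-dom-g x) (⇔-sym (is-just⇔InDom G.p x)))))

    range-h : ∀ x → H.range x ≡ G.range x
    range-h x = cong (lower x ∧_) (Bool-⇔ (⇔-trans (does⇔InRange h x) (⇔-trans (⇔-sym (ran-gh x)) (⇔-sym (does⇔InRange g x)))))

    chain : ∀ {x z} → F.p x ≡ just z → ∃ λ w → G.p z ≡ just w × H.p x ≡ just w
    chain {x} {z} px≡z with Equivalence.to (ran-f-dom-g z) (x , px≡z)
    ... | w , gz≡w = w , gz≡w , trans (h≡g∘f x) (trans (cong (_>>= G.p) px≡z) gz≡w)

    image-h : ∀ x → F.domain x ≡ true → H.image x ≡ G.image (F.image x)
    image-h x x∈ with F.domain-true x x∈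
    ... | _ , z , px≡z with chain px≡z
    ...   | w , gz≡w , hx≡w = trans (H.image-just hx≡w) (sym (trans (cong G.image (F.image-just px≡z)) (G.image-rep gz≡w)))

    open Composition F.partialBijection G.partialBijection H.partialBijection domain-h range-f range-h image-h

    domain-g : ∀ x → G.domain (F.π x) ≡ F.domain x
    domain-g x = trans (sym (range-f (F.π x))) (ran-extend F.partialBijection x)

    shift-h : ∀ x → H.shift′ x ≡ F.shift′ x xor G.shift′ (F.π x)
    shift-h x = by (F.domain x) refl
      where
      by : ∀ b → F.domain x ≡ b → H.shift′ x ≡ F.shift′ x xor G.shift′ (F.π x)
      by true x∈ with F.domain-true x x∈
      ... | l , z , px≡z with chain px≡z
      ...   | w , gz≡w , hx≡w = begin
        H.shift′ x                           ≡⟨ H.shift-just hx≡w l ⟩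
        side w                               ≡⟨ xor-cancelˡ (side z) (side w) ⟨
        side z xor (side z xor side w)       ≡⟨ cong₂ _xor_ (F.shift-just px≡z l) (G.shift-rep gz≡w) ⟨
        F.shift′ x xor G.shift′ (rep z)      ≡⟨ cong (λ y → F.shift′ x xor G.shift′ y)
                                                  (trans (extend-dom F.partialBijection x x∈) (F.image-just px≡z)) ⟨
        F.shift′ x xor G.shift′ (F.π x)      ∎
        where open ≡-Reasoning
      by false x∉ = trans (H.shift-outside x (trans (domain-h x) x∉))
        (sym (cong₂ _xor_ (F.shift-outside x x∉) (G.shift-outside (F.π x) (trans (domain-g x) x∉))))

    defect-h : ∀ x y → H.defect x y ≡ F.defect x y xor G.defect (F.π x) (F.π y)
    defect-h x y = begin
      (two (H.π x) (H.π y) xor two x y) xor (H.shift′ x xor H.shift′ y)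
        ≡⟨ cong₂ (λ a b → (a xor two x y) xor b) (cong₂ two (extend-compose x) (extend-compose y)) (cong₂ _xor_ (shift-h x) (shift-h y)) ⟩
      (t₂ xor two x y) xor ((F.shift′ x xor G.shift′ (F.π x)) xor (F.shift′ y xor G.shift′ (F.π y)))
        ≡⟨ cocycle t₂ (two x y) t₁ (F.shift′ x) (G.shift′ (F.π x)) (F.shift′ y) (G.shift′ (F.π y)) ⟩
      ((t₁ xor two x y) xor (F.shift′ x xor F.shift′ y)) xor ((t₂ xor t₁) xor (G.shift′ (F.π x) xor G.shift′ (F.π y)))
        ∎
      where
      open ≡-Reasoning
      t₁ = two (F.π x) (F.π y)
      t₂ = two (G.π (F.π x)) (G.π (F.π y))
      cocycle : ∀ t₂ t₀ t₁ a b c e → (t₂ xor t₀) xor ((a xor b) xor (c xor e)) ≡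
                                     ((t₁ xor t₀) xor (a xor c)) xor ((t₂ xor t₁) xor (b xor e))
      cocycle = solve 7 (λ t₂ t₀ t₁ a b c e → (t₂ :+ t₀) :+ ((a :+ b) :+ (c :+ e)) :=
                                             ((t₁ :+ t₀) :+ (a :+ c)) :+ ((t₂ :+ t₁) :+ (b :+ e))) refl

    switch-h : ∀ x y → H.switch′ x y ≡ F.switch′ x y xor G.switch′ (F.π x) (F.π y)
    switch-h x y = by (F.domain x) refl
      where
      by : ∀ b → F.domain x ≡ b → H.switch′ x y ≡ F.switch′ x y xor G.switch′ (F.π x) (F.π y)
      by true x∈ = trans (H.switch-outside x y (trans (domain-h x) x∈))
        (sym (cong₂ _xor_ (F.switch-outside x y x∈) (G.switch-outside _ _ (trans (domain-g x) x∈))))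
      by false x∉ = begin
        H.switch′ x y
          ≡⟨ H.switch-inside x y (trans (domain-h x) x∉) ⟩
        before H.partialBijection x y ∧ H.defect x y
          ≡⟨ cong₂ _∧_ (before-same-dom x y) (defect-h x y) ⟩
        before F.partialBijection x y ∧ (F.defect x y xor G.defect (F.π x) (F.π y))
          ≡⟨ ∧-distribˡ-xor (before F.partialBijection x y) _ _ ⟩
        (before F.partialBijection x y ∧ F.defect x y) xor (before F.partialBijection x y ∧ G.defect (F.π x) (F.π y))
          ≡⟨ cong₂ _xor_ (F.switch-inside x y x∉)
                 (trans (G.switch-inside _ _ (trans (domain-g x) x∉)) (cong (_∧ G.defect (F.π x) (F.π y)) (before-transport x y x∉))) ⟨
        F.switch′ x y xor G.switch′ (F.π x) (F.π y) ∎
        where open ≡-Reasoning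

    extensions-compose : ∀ k → Aut.perm H.extension ⟨$⟩ʳ k ≡ Aut.perm G.extension ⟨$⟩ʳ (Aut.perm F.extension ⟨$⟩ʳ k)
    extensions-compose k = cong code (begin
      act H.switching (decode k)                                  ≡⟨ act-compose F.switching G.switching H.switching extend-compose shift-h switch-h (decode k) ⟩
      act G.switching (act F.switching (decode k))                ≡⟨ cong (act G.switching) (decode-code _) ⟨
      act G.switching (decode (code (act F.switching (decode k))))  ∎)
      where open ≡-Reasoning

coherent-automorphisms : ∀ {m} {B : AntipodalMetric3 m} (σ τ ρ : Aut B) →
  (∀ x → Aut.perm ρ ⟨$⟩ʳ x ≡ Aut.perm τ ⟨$⟩ʳ (Aut.perm σ ⟨$⟩ʳ x)) →
  Coherent (asPartial σ) (asPartial τ) (asPartial ρ)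
coherent-automorphisms σ τ ρ ρ≗τ∘σ =
    (λ x → mk⇔ (λ _ → _ , refl) (λ _ → _ , refl))
  , (λ x → mk⇔ (λ _ → _ , refl) (λ _ → onto σ x))
  , (λ x → mk⇔ (λ _ → onto ρ x) (λ _ → onto τ x))
  , (λ x → cong just (ρ≗τ∘σ x))
  where
  onto : ∀ σ y → InRange (asPartial σ) y
  onto σ y = Aut.perm σ ⟨$⟩ˡ y , cong just (inverseʳ (Aut.perm σ))

theorem1p4 : ∀ (n : ℕ) (A : AntipodalMetric3 n) →
    ∃ λ (m : ℕ) → Σ (AntipodalMetric3 m) λ B → Σ (Embedding A B) λ e →
      Σ (PartialAut A → Aut B) λ ext →
        (∀ (f : PartialAut A) → Extends e (proj₁ f) (ext f)) ×
        (∀ (f g h : PartialAut A) → Coherent (proj₁ f) (proj₁ g) (proj₁ h) →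
          Coherent (asPartial (ext f)) (asPartial (ext g)) (asPartial (ext h)))
theorem1p4 n A = size , metric , embedding , extension , extends , coherent
  where
  open Construction A
  open Extension using (extension; extends)
  coherent : ∀ f g h → Coherent (proj₁ f) (proj₁ g) (proj₁ h) →
             Coherent (asPartial (extension f)) (asPartial (extension g)) (asPartial (extension h))
  coherent f g h coh = coherent-automorphisms (extension f) (extension g) (extension h)
                                              (Coherence.extensions-compose f g h coh)
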